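{- Let $\mathscr{A}=(Q,\Sigma,\delta)$ be an aperiodically $1$-contracting DFA with state set $Q=\{q_1,\ldots,q_n\}$, and let $W=\{w_1,\ldots,w_n\}$ be a $1$-contracting collection with $w_i$ excluding $q_i$ and with $\sigma_W$ a cyclic permutation of $Q$. Define $\mathscr{S}_{k,i},\mathscr{T}_k,\mathscr{U}_{k,i}$ as in the context. Let $S\subseteq Q$ and $0\le k\le n-1$. If $S\in\mathscr{S}_{k,i}$ for some $i$, or $S\in\mathscr{U}_{k,i}$ for some $i$, or $S\in\mathscr{T}_k$, then $|S|=n-k$.
   Context: DFA $\mathscr{A}=(Q,\Sigma,\delta)$, transition function extended to words and to subsets by $\delta(S,w)=\{\delta(q,w)\mid q\in S\}$; $\delta^{ -1}(q,w)=\{p\in Q\mid\delta(p,w)=q\}$. A word $w$ is $1$-deficient excluding $q$ if $\delta(Q,w)=Q\setminus\{q\}$; then exactly one state $q^c$ has $|\delta^{ -1}(q^c,w)|=2$ (its contracting state). A $1$-contracting collection contains, for each $q\in Q$, exactly one $1$-deficient word excluding $q$; its state map $\sigma_W$ sends $q$ to the contracting state of that word. $\mathscr{A}$ is aperiodically $1$-contracting if some such $W$ has $\sigma_W$ a cyclic permutation (single $n$-cycle). Write $q_i^c=\sigma_W(q_i)$, the contracting state of $w_i$. Define $\mathscr{S}_{0,i}=\mathscr{T}_0=\mathscr{U}_{0,i}=\{Q\}$ for all $i$, and recursively for $k=1,\ldots,n-1$: $\mathscr{S}_{k,i}=\{\delta(S,w_i)\mid S\in\mathscr{U}_{k-1,i}\}$,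 $\mathscr{T}_k=\bigcup_{i=1}^n\mathscr{S}_{k,i}$, $\mathscr{U}_{k,i}=\{S\in\mathscr{T}_k\mid \delta^{ -1}(q_i^c,w_i)\subseteq S\}$. -}

module Defs where

open import Data.Nat using (ℕ; zero; suc; _≤_; _∸_)
open import Data.Fin using (Fin; zero; suc; _≟_)
open import Data.Fin.Subset using (Subset; ⊤; ∁; ⁅_⁆; _⊆_; ∣_∣)
open import Data.Bool using (Bool; false; _∧_; _∨_)
open import Data.List using (List; []; _∷_)
open import Data.Vec using (tabulate; lookup)
open import Data.Product using (Σ; ∃; ∃-syntax; _×_)
open import Function using (id; _∘_)
open import Function.Definitions using (Injective)
open import Relation.Nullary.Decidable using (⌊_⌋)
open import Relation.Binary.PropositionalEquality using (_≡_)

Trans : ℕ → Set → Set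
Trans n A = Fin n → A → Fin n

δ* : ∀ {n A} → Trans n A → Fin n → List A → Fin n
δ* δ p []      = p
δ* δ p (a ∷ w) = δ* δ (δ p a) w

anyFin : ∀ {n} → (Fin n → Bool) → Bool
anyFin {zero}  f = false
anyFin {suc n} f = f zero ∨ anyFin (f ∘ suc)

image : ∀ {n A} → Trans n A → Subset n → List A → Subset n
image δ S w = tabulate (λ q → anyFin (λ p → lookup S p ∧ ⌊ δ* δ p w ≟ q ⌋))

preimage : ∀ {n A} → Trans n A → Fin n → List A → Subset n
preimage δ q w = tabulate (λ p → ⌊ δ* δ p w ≟ q ⌋)

OneDeficientExcluding : ∀ {n A} → Trans n A → List A → Fin n → Set
OneDeficientExcluding δ w q = image δ ⊤ w ≡ ∁ ⁅ q ⁆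

IsContractingState : ∀ {n A} → Trans n A → List A → Fin n → Set
IsContractingState δ w q = ∣ preimage δ q w ∣ ≡ 2

iter : ∀ {n} → (Fin n → Fin n) → ℕ → Fin n → Fin n
iter σ zero    = id
iter σ (suc m) = σ ∘ iter σ m

IsCyclicPermutation : ∀ {n} → (Fin n → Fin n) → Set
IsCyclicPermutation {n} σ =
  Injective _≡_ _≡_ σ × (∀ p q → ∃[ m ] iter σ m p ≡ q)

-- The families 𝒮_{k,i}, 𝒯_k, 𝒰_{k,i} as membership predicates,
-- given δ, the words w_i and the contracting states q_i^c = σ i.
module Families {n : ℕ} {A : Set} (δ : Trans n A)
                (w : Fin n → List A) (σ : Fin n → Fin n) where
  mutual
    InS : ℕ → Fin n → Subset n → Set
    InS zero    i S = S ≡ ⊤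
    InS (suc k) i S = ∃[ S′ ] (InU k i S′ × S ≡ image δ S′ (w i))

    InT : ℕ → Subset n → Set
    InT zero    S = S ≡ ⊤
    InT (suc k) S = ∃[ i ] InS (suc k) i S

    InU : ℕ → Fin n → Subset n → Set
    InU zero    i S = S ≡ ⊤
    InU (suc k) i S = InT (suc k) S × (preimage δ (σ i) (w i) ⊆ S)

module Submission where

-- Every family 𝒮_{k,i}, 𝒯_k, 𝒰_{k,i} is obtained from Q
-- by k steps of the form S ↦ δ(S, w_i) applied to a set S ⊇ δ⁻¹(q_i^c, w_i).
-- So it suffices to show that such a step removes exactly one state:
--
--   if f : Q → Q has image of size n − 1 and the fibre f⁻¹(c) has two
--   elements, then |f(S)| = |S| − 1 for every S ⊇ f⁻¹(c).
--
-- This is a double-counting argument.  Splitting S along the fibres of f,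
--   |S| = |f(S)| + Σ_q (|S ∩ f⁻¹(q)| − 1),
-- where the "excess" sum is monotone in S.  For S = Q it equals n − (n−1) = 1,
-- while for S ⊇ f⁻¹(c) it is at least |f⁻¹(c)| − 1 = 1; hence it is 1.
-- The file first develops finite counting over Fin (via the library's finite
-- sums), then this fibre decomposition for an arbitrary map Fin n → Fin m,
-- then the shrinking step for a 1-deficient word, and finally the sizes of
-- the families by simultaneous induction on k.

open import Defs
open import Data.Nat using (ℕ; _≤_; _∸_)
open import Data.Fin using (Fin)
open import Data.Fin.Subset using (Subset; ∣_∣)
open import Data.List using (List)
open import Data.Product using (∃-syntax; _×_)
open import Data.Sum using (_⊎_)
open import Relation.Binary.PropositionalEquality using (_≡_)

open import Data.Nat using (zero; suc; pred; _+_; z≤n; s≤s)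
open import Data.Nat.Properties
  using (+-0-commutativeMonoid; +-identityʳ; +-comm; +-mono-≤; +-cancelˡ-≡;
         m≤m+n; ≤-refl; ≤-antisym; ∸-monoˡ-≤; n≤0⇒n≡0; pred[m∸n]≡m∸[1+n])
open import Data.Fin using (zero; suc; _≟_; punchIn)
open import Data.Fin.Properties using (punchInᵢ≢i)
open import Data.Fin.Subset using (⊤; ∁; ⁅_⁆)
open import Data.Fin.Subset.Properties using (∣⊤∣≡n; ∣∁p∣≡n∸∣p∣; ∣⁅x⁆∣≡1)
open import Data.Bool using (Bool; true; false; _∧_; _∨_)
open import Data.Bool.Properties using (∧-identityʳ; ∧-zeroʳ)
open import Data.Vec using ([]; _∷_; lookup; tabulate)
open import Data.Vec.Properties
  using (lookup∘tabulate; lookup⇒[]=; []=⇒lookup; lookup-replicate)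
open import Data.Vec.Functional using (removeAt)
open import Data.Product using (_,_)
open import Data.Sum using (inj₁; inj₂)
open import Relation.Nullary.Decidable using (yes; no; ⌊_⌋; isYes≗does; dec-true; dec-false)
open import Relation.Binary.PropositionalEquality
  using (_≢_; refl; sym; trans; cong; cong₂; subst; module ≡-Reasoning)
open import Function using (_∘_)

open import Algebra.Properties.CommutativeMonoid.Sum +-0-commutativeMonoid
  using (sum; sum-syntax; sum-remove; sum-cong-≗; sum-replicate-zero; ∑-comm; ∑-distrib-+)

term≤sum : ∀ {k} (g : Fin k → ℕ) (c : Fin k) → g c ≤ sum g
term≤sum {suc _} g c = subst (g c ≤_) (sym (sum-remove {i = c} g)) (m≤m+n (g c) _)

sum-mono : ∀ {k} {g h : Fin k → ℕ} → (∀ i → g i ≤ h i) → sum g ≤ sum h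
sum-mono {zero}  g≤h = z≤n
sum-mono {suc _} g≤h = +-mono-≤ (g≤h zero) (sum-mono (g≤h ∘ suc))

sum-concentrated : ∀ {k} (g : Fin k → ℕ) (c : Fin k) →
                   (∀ d → d ≢ c → g d ≡ 0) → sum g ≡ g c
sum-concentrated {suc k} g c vanish = begin
  sum g                       ≡⟨ sum-remove {i = c} g ⟩
  g c + sum (removeAt g c)    ≡⟨ cong (g c +_) rest≡0 ⟩
  g c + 0                     ≡⟨ +-identityʳ (g c) ⟩
  g c                         ∎
  where
  open ≡-Reasoning
  rest≡0 : sum (removeAt g c) ≡ 0
  rest≡0 = trans (sum-cong-≗ (λ j → vanish (punchIn c j) (punchInᵢ≢i c j)))
                 (sum-replicate-zero k)

≟-true : ∀ {m} {x y : Fin m} → x ≡ y → ⌊ x ≟ y ⌋ ≡ true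
≟-true {x = x} {y} x≡y = trans (isYes≗does (x ≟ y)) (dec-true (x ≟ y) x≡y)

≟-sound : ∀ {m} {x y : Fin m} → ⌊ x ≟ y ⌋ ≡ true → x ≡ y
≟-sound {x = x} {y} _ with x ≟ y
≟-sound _  | yes x≡y = x≡y
≟-sound () | no _

≟-false : ∀ {m} {x y : Fin m} → x ≢ y → ⌊ x ≟ y ⌋ ≡ false
≟-false {x = x} {y} x≢y = trans (isYes≗does (x ≟ y)) (dec-false (x ≟ y) x≢y)

bit : Bool → ℕ
bit true  = 1
bit false = 0

bit-∧≤ : ∀ a b → bit (a ∧ b) ≤ bit b
bit-∧≤ true  b = ≤-refl
bit-∧≤ false b = z≤n

∧-superset : ∀ a b → (b ≡ true → a ≡ true) → a ∧ b ≡ b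
∧-superset true  b     _    = refl
∧-superset false false _    = refl
∧-superset false true  b⇒a  = b⇒a refl

count : ∀ {n} → (Fin n → Bool) → ℕ
count {n} s = ∑[ p < n ] bit (s p)

count-cong : ∀ {n} {s t : Fin n → Bool} → (∀ p → s p ≡ t p) → count s ≡ count t
count-cong s≗t = sum-cong-≗ (cong bit ∘ s≗t)

count-full : ∀ n → count {n} (λ _ → true) ≡ n
count-full zero    = refl
count-full (suc n) = cong suc (count-full n)

∣∣≡count : ∀ {n} (S : Subset n) → ∣ S ∣ ≡ count (lookup S)
∣∣≡count []          = refl
∣∣≡count (true  ∷ S) = cong suc (∣∣≡count S)
∣∣≡count (false ∷ S) = ∣∣≡count S

∣tabulate∣≡count : ∀ {n} (s : Fin n → Bool) → ∣ tabulate s ∣ ≡ count s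
∣tabulate∣≡count s = trans (∣∣≡count (tabulate s)) (count-cong (lookup∘tabulate s))

anyFin-cong : ∀ {n} {s t : Fin n → Bool} → (∀ p → s p ≡ t p) → anyFin s ≡ anyFin t
anyFin-cong {zero}  s≗t = refl
anyFin-cong {suc _} s≗t = cong₂ _∨_ (s≗t zero) (anyFin-cong (s≗t ∘ suc))

bit-anyFin≤count : ∀ {n} (s : Fin n → Bool) → bit (anyFin s) ≤ count s
bit-anyFin≤count {zero}  s = z≤n
bit-anyFin≤count {suc _} s with s zero
... | true  = s≤s z≤n
... | false = bit-anyFin≤count (s ∘ suc)

count-pos⇒anyFin : ∀ {n} (s : Fin n → Bool) → 1 ≤ count s → anyFin s ≡ true
count-pos⇒anyFin {suc _} s pos with s zero
... | true  = refl
... | false = count-pos⇒anyFin (s ∘ suc) pos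

anyFin+surplus : ∀ {n} (s : Fin n → Bool) → bit (anyFin s) + (count s ∸ 1) ≡ count s
anyFin+surplus s with count s in eq
... | zero  = trans (+-identityʳ _) (n≤0⇒n≡0 (subst (bit (anyFin s) ≤_) eq (bit-anyFin≤count s)))
... | suc _ rewrite count-pos⇒anyFin s (subst (1 ≤_) (sym eq) (s≤s z≤n)) = refl

module Fibres {n m : ℕ} (f : Fin n → Fin m) where

  inFibre : (Fin n → Bool) → Fin m → Fin n → Bool
  inFibre s q p = s p ∧ ⌊ f p ≟ q ⌋

  hits : (Fin n → Bool) → Fin m → Bool
  hits s q = anyFin (inFibre s q)

  excess : (Fin n → Bool) → Fin m → ℕ
  excess s q = count (inFibre s q) ∸ 1

  full : Fin n → Bool
  full _ = true

  bit-by-fibres : ∀ s p → bit (s p) ≡ ∑[ q < m ] bit (inFibre s q p)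
  bit-by-fibres s p = sym (trans
    (sum-concentrated (λ q → bit (inFibre s q p)) (f p)
      (λ q q≢fp → cong bit (trans (cong (s p ∧_) (≟-false (q≢fp ∘ sym)))
                                  (∧-zeroʳ (s p)))))
    (cong bit (trans (cong (s p ∧_) (≟-true refl)) (∧-identityʳ (s p)))))

  count-by-fibres : ∀ s → count s ≡ count (hits s) + ∑[ q < m ] excess s q
  count-by-fibres s = begin
    count s                                                 ≡⟨ sum-cong-≗ (bit-by-fibres s) ⟩
    ∑[ p < n ] ∑[ q < m ] bit (inFibre s q p)               ≡⟨ ∑-comm (λ p q → bit (inFibre s q p)) ⟩
    ∑[ q < m ] count (inFibre s q)                          ≡⟨ sum-cong-≗ (sym ∘ anyFin+surplus ∘ inFibre s) ⟩
    ∑[ q < m ] (bit (hits s q) + excess s q)                ≡⟨ ∑-distrib-+ (bit ∘ hits s) (excess s) ⟩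
    count (hits s) + ∑[ q < m ] excess s q                  ∎
    where open ≡-Reasoning

  excess-mono : ∀ s q → excess s q ≤ excess full q
  excess-mono s q = ∸-monoˡ-≤ 1 (sum-mono (λ p → bit-∧≤ (s p) ⌊ f p ≟ q ⌋))

  shrinks-by-one : (c : Fin m) →
                   count (hits full) + 1 ≡ n → count (inFibre full c) ≡ 2 →
                   ∀ s → (∀ p → f p ≡ c → s p ≡ true) → count s ≡ suc (count (hits s))
  shrinks-by-one c image-size fibre-size s fibre⊆s = begin
    count s                   ≡⟨ count-by-fibres s ⟩
    count (hits s) + E s      ≡⟨ cong (count (hits s) +_) E-s≡1 ⟩
    count (hits s) + 1        ≡⟨ +-comm (count (hits s)) 1 ⟩
    suc (count (hits s))      ∎
    where
    open ≡-Reasoning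

    E : (Fin n → Bool) → ℕ
    E t = ∑[ q < m ] excess t q

    -- On the whole domain the total excess is n − (n − 1) = 1.
    E-full≡1 : E full ≡ 1
    E-full≡1 = +-cancelˡ-≡ (count (hits full)) (E full) 1
      (trans (sym (count-by-fibres full)) (trans (count-full n) (sym image-size)))

    -- s contains the whole fibre over c, which contributes excess 2 − 1 = 1.
    excess-s-c≡1 : excess s c ≡ 1
    excess-s-c≡1 = cong (_∸ 1) (trans (count-cong (λ p →
      ∧-superset (s p) ⌊ f p ≟ c ⌋ (fibre⊆s p ∘ ≟-sound))) fibre-size)

    E-s≡1 : E s ≡ 1
    E-s≡1 = ≤-antisym (subst (E s ≤_) E-full≡1 (sum-mono (excess-mono s)))
                      (subst (_≤ E s) excess-s-c≡1 (term≤sum (excess s) c))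

deficient-step : ∀ {n A} (δ : Trans n A) (w : List A) (i c : Fin n) →
                 OneDeficientExcluding δ w i → IsContractingState δ w c →
                 (S : Subset n) → (∀ p → δ* δ p w ≡ c → lookup S p ≡ true) →
                 ∣ S ∣ ≡ suc ∣ image δ S w ∣
deficient-step {zero}   δ w () c
deficient-step {suc n′} δ w i c deficient contracting S fibre⊆S = begin
  ∣ S ∣                           ≡⟨ ∣∣≡count S ⟩
  count (lookup S)                ≡⟨ shrinks-by-one c image-size fibre-size (lookup S) fibre⊆S ⟩
  suc (count (hits (lookup S)))   ≡⟨ cong suc (∣tabulate∣≡count (hits (lookup S))) ⟨
  suc ∣ image δ S w ∣             ∎
  where
  open ≡-Reasoning
  open Fibres (λ p → δ* δ p w)

  image≡n′ : count (hits full) ≡ n′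
  image≡n′ = begin
    count (hits full)               ≡⟨ count-cong (λ q → anyFin-cong (λ p →
                                         cong (_∧ ⌊ δ* δ p w ≟ q ⌋) (sym (lookup-replicate p true)))) ⟩
    count (hits (lookup ⊤))         ≡⟨ ∣tabulate∣≡count (hits (lookup ⊤)) ⟨
    ∣ image δ ⊤ w ∣                 ≡⟨ cong ∣_∣ deficient ⟩
    ∣ ∁ ⁅ i ⁆ ∣                     ≡⟨ ∣∁p∣≡n∸∣p∣ ⁅ i ⁆ ⟩
    suc n′ ∸ ∣ ⁅ i ⁆ ∣              ≡⟨ cong (suc n′ ∸_) (∣⁅x⁆∣≡1 i) ⟩
    n′                              ∎

  image-size : count (hits full) + 1 ≡ suc n′
  image-size = trans (cong (_+ 1) image≡n′) (+-comm n′ 1)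

  fibre-size : count (inFibre full c) ≡ 2
  fibre-size = trans (sym (∣tabulate∣≡count (inFibre full c))) contracting

one-smaller : ∀ {x y} n k → y ≡ suc x → y ≡ n ∸ k → x ≡ n ∸ suc k
one-smaller n k y≡1+x y≡n-k = trans (cong pred (trans (sym y≡1+x) y≡n-k)) (pred[m∸n]≡m∸[1+n] n k)

module FamilySizes {n : ℕ} {A : Set} (δ : Trans n A) (w : Fin n → List A) (σ : Fin n → Fin n)
                   (deficient   : ∀ i → OneDeficientExcluding δ (w i) i)
                   (contracting : ∀ i → IsContractingState δ (w i) (σ i)) where

  open Families δ w σ

  U-contains-fibre : ∀ k i S → InU k i S → ∀ p → δ* δ p (w i) ≡ σ i → lookup S p ≡ true
  U-contains-fibre zero    i S refl           p _   = lookup-replicate p true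
  U-contains-fibre (suc k) i S (_ , fibre⊆S) p eq =
    []=⇒lookup (fibre⊆S (lookup⇒[]= p (preimage δ (σ i) (w i))
                           (trans (lookup∘tabulate _ p) (≟-true eq))))

  sizeS : ∀ k i S → InS k i S → ∣ S ∣ ≡ n ∸ k
  sizeU : ∀ k i S → InU k i S → ∣ S ∣ ≡ n ∸ k
  sizeT : ∀ k S → InT k S → ∣ S ∣ ≡ n ∸ k

  sizeS zero    i S refl = ∣⊤∣≡n n
  sizeS (suc k) i _ (S′ , S′∈U , refl) = one-smaller n k
    (deficient-step δ (w i) i (σ i) (deficient i) (contracting i) S′ (U-contains-fibre k i S′ S′∈U))
    (sizeU k i S′ S′∈U)

  sizeU zero    i S refl       = ∣⊤∣≡n n
  sizeU (suc k) i S (S∈T , _) = sizeT (suc k) S S∈T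

  sizeT zero    S refl       = ∣⊤∣≡n n
  sizeT (suc k) S (i , S∈S) = sizeS (suc k) i S S∈S

  size : ∀ k S → (∃[ i ] InS k i S) ⊎ (∃[ i ] InU k i S) ⊎ InT k S → ∣ S ∣ ≡ n ∸ k
  size k S (inj₁ (i , S∈S))        = sizeS k i S S∈S
  size k S (inj₂ (inj₁ (i , S∈U))) = sizeU k i S S∈U
  size k S (inj₂ (inj₂ S∈T))       = sizeT k S S∈T

lemma3 : {n : ℕ} {A : Set} (δ : Trans n A) (w : Fin n → List A) (σ : Fin n → Fin n) →
         (∀ i → OneDeficientExcluding δ (w i) i) →
         (∀ i → IsContractingState δ (w i) (σ i)) →
         IsCyclicPermutation σ →
         (k : ℕ) → k ≤ n ∸ 1 → (S : Subset n) →
         ((∃[ i ] Families.InS δ w σ k i S) ⊎ (∃[ i ] Families.InU δ w σ k i S) ⊎ Families.InT δ w σ k S) →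
         ∣ S ∣ ≡ n ∸ k
lemma3 δ w σ deficient contracting _ k _ S = FamilySizes.size δ w σ deficient contracting k S
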